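{- Let $(\Gamma,N)$ and $(\Gamma',N')$ be equivalent link-regular numbered graphs, and let $\sigma\subseteq V\Gamma$ and $\sigma'\subseteq V\Gamma'$ be cliques with $N(\sigma)=N'(\sigma')$. Then for any $\tau\subseteq\sigma$ and $\tau'\subseteq\sigma'$ with $N(\tau)=N'(\tau')$, we have $N(\mathrm{Lk}(\sigma;\tau))=N'(\mathrm{Lk}(\sigma';\tau'))$.
   Context: A numbered graph $(\Gamma,N)$ is a finite simplicial graph with a map $N:V\Gamma\to\{2,3,\dots\}$. A clique is a vertex set spanning a complete subgraph; $\mathrm{Lk}(\sigma)=\{v\notin\sigma\mid\sigma\cup\{v\}\text{ is a clique}\}$, $\mathrm{Lk}(v)=\mathrm{Lk}(\{v\})$; for $\tau\subseteq\sigma$, $\mathrm{Lk}(\sigma;\tau)=\{v\in V\Gamma\setminus\sigma\mid\mathrm{Lk}(v)\cap\sigma=\tau\}$. $N(U)$ is the multiset $\{N(v)\mid v\in U\}$. $(\Gamma,N)$ is link-regular if $N(\sigma_1)=N(\sigma_2)$ implies $N(\mathrm{Lk}(\sigma_1))=N(\mathrm{Lk}(\sigma_2))$ for cliques $\sigma_1,\sigma_2$. Link-regular $(\Gamma,N)$, $(\Gamma',N')$ are equivalent if $N(V\Gamma)=N'(V\Gamma')$ and whenever cliques $\sigma\subseteq V\Gamma$, $\sigma'\subseteq V\Gamma'$ satisfy $N(\sigma)=N'(\sigma')$, then $N(\mathrm{Lk}(\sigma))=N'(\mathrm{Lk}(\sigma'))$. -}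

module Defs where

open import Data.Nat using (ℕ; _≤_; _≡ᵇ_)
open import Data.Bool using (Bool; true; false; _∧_; _∨_; not; if_then_else_)
open import Data.Fin using (Fin; _≟_)
open import Data.Fin.Subset using (Subset; _∈_; _⊆_; _∪_; _∩_; ⁅_⁆)
open import Data.Vec using (lookup; tabulate)
open import Data.List using (List; length; filterᵇ)
open import Data.Bool.ListAction using (all)
open import Data.List.Base using (allFin)
open import Relation.Binary.PropositionalEquality using (_≡_)
open import Relation.Nullary.Decidable using (⌊_⌋)

record NumberedGraph : Set where
  field
    size      : ℕ
    adj       : Fin size → Fin size → Bool
    adj-sym   : ∀ u v → adj u v ≡ adj v u
    adj-irref : ∀ v → adj v v ≡ false
    N         : Fin size → ℕ
    N≥2       : ∀ v → 2 ≤ N v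

open NumberedGraph public

V : (G : NumberedGraph) → Set
V G = Fin (size G)

Vset : (G : NumberedGraph) → Set
Vset G = Subset (size G)

verts : (G : NumberedGraph) → List (V G)
verts G = allFin (size G)

isCliqueᵇ : (G : NumberedGraph) → Vset G → Bool
isCliqueᵇ G σ =
  all (λ u → all (λ w →
         not (lookup σ u) ∨ not (lookup σ w) ∨ ⌊ u ≟ w ⌋ ∨ adj G u w)
       (verts G)) (verts G)

IsClique : (G : NumberedGraph) → Vset G → Set
IsClique G σ = isCliqueᵇ G σ ≡ true

Lk : (G : NumberedGraph) → Vset G → Vset G
Lk G σ = tabulate (λ v → not (lookup σ v) ∧ isCliqueᵇ G (σ ∪ ⁅ v ⁆))

_=ˢ_ : ∀ {n} → Subset n → Subset n → Bool
_=ˢ_ {n} A B = all (λ v → eqB (lookup A v) (lookup B v)) (allFin n)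
  where
  eqB : Bool → Bool → Bool
  eqB true b = b
  eqB false b = not b

LkRel : (G : NumberedGraph) → Vset G → Vset G → Vset G
LkRel G σ τ = tabulate (λ v → not (lookup σ v) ∧ ((Lk G ⁅ v ⁆ ∩ σ) =ˢ τ))

mult : (G : NumberedGraph) → Vset G → ℕ → ℕ
mult G U k = length (filterᵇ (λ v → lookup U v ∧ (N G v ≡ᵇ k)) (verts G))

-- N(U) = N'(U') as multisets
SameN : (G G' : NumberedGraph) → Vset G → Vset G' → Set
SameN G G' U U' = ∀ k → mult G U k ≡ mult G' U' k

full : (G : NumberedGraph) → Vset G
full G = tabulate (λ _ → true)

LinkRegular : NumberedGraph → Set
LinkRegular G = ∀ (σ₁ σ₂ : Vset G) → IsClique G σ₁ → IsClique G σ₂ →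
  SameN G G σ₁ σ₂ → SameN G G (Lk G σ₁) (Lk G σ₂)

Equivalent : NumberedGraph → NumberedGraph → Set
Equivalent G G' =
  SameN G G' (full G) (full G') ×'
  (∀ (σ : Vset G) (σ' : Vset G') → IsClique G σ → IsClique G' σ' →
     SameN G G' σ σ' → SameN G G' (Lk G σ) (Lk G' σ'))
  where
  open import Data.Product using () renaming (_×_ to _×'_)

-- Induction on |σ ∖ τ|.  When τ = σ, Lk(σ;σ) = Lk(σ) and the equivalence applies directly.
-- Otherwise N(σ ∖ τ) = N'(σ' ∖ τ') supplies x ∈ σ ∖ τ and x' ∈ σ' ∖ τ' with N(x) = N'(x').
-- Deleting x from σ splits the relative link:
--   Lk(σ ∖ x; τ) = Lk(σ; τ) ⊔ Lk(σ; τ ∪ x) ⊔ ({x} if σ ∖ x = τ),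
-- according to whether a vertex outside σ is adjacent to x (x itself is adjacent to all of
-- σ ∖ x).  The pairs (σ ∖ x, τ) and (σ, τ ∪ x) are smaller, the test σ ∖ x = τ is decided by
-- the multisets N(σ ∖ x) and N(τ), and the same splitting holds in Γ', so N(Lk(σ;τ)) is
-- obtained by cancellation.
module Submission where

open import Algebra.Properties.CommutativeSemigroup using (interchange; x∙yz≈y∙xz)
open import Data.Bool using (Bool; true; false; _∧_; _∨_; not)
import Data.Bool as Bool
open import Data.Bool.ListAction using (all)
open import Data.Bool.Properties
  using (T-≡; ⇔→≡; ¬-not; not-injective; ∧-zeroʳ; ∧-identityʳ; ∧-conicalˡ; ∧-conicalʳ;
         ∨-identityʳ; ∨-zeroʳ)
open import Data.Empty using (⊥-elim)
open import Data.Fin using (Fin; zero; suc; _≟_)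
import Data.Fin.Properties as Fin
open import Data.Fin.Subset using (Subset; _⊆_; _∪_; _∩_; _─_; ⁅_⁆)
open import Data.Fin.Subset.Properties using (x∈⁅x⁆; x∈⁅y⁆⇔x≡y)
open import Data.List using (length; filterᵇ; allFin) renaming (tabulate to tabulateˡ)
open import Data.List.Membership.Propositional.Properties using (∈-allFin)
import Data.List.Relation.Unary.All as All
open import Data.List.Relation.Unary.All.Properties using (all⁺; all⁻; tabulate⁺)
open import Data.Nat using (ℕ; zero; suc; _+_; _≡ᵇ_)
open import Data.Nat.Properties
  using (+-commutativeSemigroup; +-identityʳ; +-cancelˡ-≡; +-cancelʳ-≡; m+n≡0⇒n≡0;
         suc-injective; 0≢1+n; ≡ᵇ⇒≡; ≡⇒≡ᵇ)
open import Data.Product using (∃; _×_; _,_; proj₁; proj₂; map)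
open import Data.Sum using (_⊎_; inj₁; inj₂)
open import Data.Vec using (_∷_; lookup; _[_]≔_)
open import Data.Vec.Properties
  using (lookup-zipWith; lookup∘tabulate; lookup∘update; lookup∘update′; []=⇒lookup; lookup⇒[]=)
open import Function using (_∘_; id; _⇔_; mk⇔; Equivalence; case_of_)
open import Relation.Binary.PropositionalEquality
open import Relation.Nullary using (¬_; Dec; yes; no)
open import Relation.Nullary.Decidable using (⌊_⌋)

open import Defs

open Equivalence using (to; from)

-- Counting over Fin n

χ : Bool → ℕ
χ true  = 1
χ false = 0

count : ∀ {n} → (Fin n → Bool) → ℕ
count {zero}  P = 0
count {suc n} P = χ (P zero) + count (P ∘ suc)

count-cong : ∀ {n} {P Q : Fin n → Bool} → P ≗ Q → count P ≡ count Q
count-cong {zero}  P≗Q = refl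
count-cong {suc n} P≗Q = cong₂ _+_ (cong χ (P≗Q zero)) (count-cong (P≗Q ∘ suc))

count-+ : ∀ {n} {P Q R : Fin n → Bool} → (∀ i → χ (P i) ≡ χ (Q i) + χ (R i)) →
          count P ≡ count Q + count R
count-+ {zero}  split = refl
count-+ {suc n} {P} {Q} {R} split = begin
  χ (P zero) + count (P ∘ suc)
    ≡⟨ cong₂ _+_ (split zero) (count-+ (split ∘ suc)) ⟩
  (χ (Q zero) + χ (R zero)) + (count (Q ∘ suc) + count (R ∘ suc))
    ≡⟨ interchange +-commutativeSemigroup (χ (Q zero)) (χ (R zero)) (count (Q ∘ suc)) (count (R ∘ suc)) ⟩
  count Q + count R ∎
  where open ≡-Reasoning

count-remove : ∀ {n} {P Q : Fin n → Bool} x → Q x ≡ false → (∀ i → i ≢ x → P i ≡ Q i) →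
               count P ≡ χ (P x) + count Q
count-remove {suc n} {P} zero Qx agree rewrite Qx =
  cong (χ (P zero) +_) (count-cong λ i → agree (suc i) λ ())
count-remove {suc n} {P} {Q} (suc x) Qx agree = begin
  χ (P zero) + count (P ∘ suc)
    ≡⟨ cong₂ _+_ (cong χ (agree zero λ ()))
                 (count-remove x Qx λ i i≢x → agree (suc i) (i≢x ∘ Fin.suc-injective)) ⟩
  χ (Q zero) + (χ (P (suc x)) + count (Q ∘ suc))
    ≡⟨ x∙yz≈y∙xz +-commutativeSemigroup (χ (Q zero)) (χ (P (suc x))) (count (Q ∘ suc)) ⟩
  χ (P (suc x)) + count Q ∎
  where open ≡-Reasoning

count-remove-true : ∀ {n} {P Q : Fin n → Bool} x → P x ≡ true → Q x ≡ false →
                    (∀ i → i ≢ x → P i ≡ Q i) → count P ≡ suc (count Q)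
count-remove-true {Q = Q} x Px Qx agree =
  trans (count-remove x Qx agree) (cong (λ b → χ b + count Q) Px)

count-all-false : ∀ {n} {P : Fin n → Bool} → (∀ i → P i ≡ false) → count P ≡ 0
count-all-false {zero}  none = refl
count-all-false {suc n} none rewrite none zero = count-all-false (none ∘ suc)

count-≢0 : ∀ {n} {P : Fin n → Bool} i → P i ≡ true → count P ≢ 0
count-≢0         zero    Pi rewrite Pi = λ ()
count-≢0 {P = P} (suc i) Pi = count-≢0 i Pi ∘ m+n≡0⇒n≡0 (χ (P zero))

count-≡0⇒false : ∀ {n} {P : Fin n → Bool} → count P ≡ 0 → ∀ i → P i ≡ false
count-≡0⇒false count≡0 i = ¬-not λ Pi → count-≢0 i Pi count≡0

count-≢0⇒∃ : ∀ {n} {P : Fin n → Bool} → count P ≢ 0 → ∃ λ i → P i ≡ true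
count-≢0⇒∃ {zero}      count≢0 = ⊥-elim (count≢0 refl)
count-≢0⇒∃ {suc n} {P} count≢0 with P zero in P0
... | true  = zero , P0
... | false = map suc id (count-≢0⇒∃ count≢0)

length-filterᵇ-tabulate : ∀ {a} {A : Set a} {n} (P : A → Bool) (f : Fin n → A) →
                          length (filterᵇ P (tabulateˡ f)) ≡ count (P ∘ f)
length-filterᵇ-tabulate {n = zero}  P f = refl
length-filterᵇ-tabulate {n = suc n} P f with P (f zero)
... | true  = cong suc (length-filterᵇ-tabulate P (f ∘ suc))
... | false = length-filterᵇ-tabulate P (f ∘ suc)

-- Subsets as boolean vectors

all-allFin : ∀ {n} {p : Fin n → Bool} → all p (allFin n) ≡ true ⇔ (∀ i → p i ≡ true)
all-allFin {n} {p} = mk⇔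
  (λ h i → to T-≡ (All.lookup (all⁺ p (allFin n) (from T-≡ h)) (∈-allFin i)))
  (λ h → to T-≡ (all⁻ p (tabulate⁺ (from T-≡ ∘ h))))

≡-⇔ : ∀ {a} {A : Set a} {x x′ y y′ : A} → x ≡ x′ → y ≡ y′ → (x ≡ y) ⇔ (x′ ≡ y′)
≡-⇔ refl refl = mk⇔ id id

∧-≡ʳ : ∀ {a b} → (b ≡ true → a ≡ true) → a ∧ b ≡ b
∧-≡ʳ {a} {false} _ = ∧-zeroʳ a
∧-≡ʳ {a} {true}  h = trans (∧-identityʳ a) (h refl)

χ-∧ʳ : ∀ a b c e → χ a ≡ χ b + χ c → χ (a ∧ e) ≡ χ (b ∧ e) + χ (c ∧ e)
χ-∧ʳ a b c true  split rewrite ∧-identityʳ a | ∧-identityʳ b | ∧-identityʳ c = split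
χ-∧ʳ a b c false _     rewrite ∧-zeroʳ a | ∧-zeroʳ b | ∧-zeroʳ c = refl

clause⇔ : ∀ {p} {P : Set p} a b (d : Dec P) c →
          (not a ∨ not b ∨ ⌊ d ⌋ ∨ c) ≡ true ⇔ (a ≡ true → b ≡ true → ¬ P → c ≡ true)
clause⇔ false b     d       c = mk⇔ (λ _ ()) (λ _ → refl)
clause⇔ true  false d       c = mk⇔ (λ _ _ ()) (λ _ → refl)
clause⇔ true  true  (yes p) c = mk⇔ (λ _ _ _ ¬p → ⊥-elim (¬p p)) (λ _ → refl)
clause⇔ true  true  (no ¬p) c = mk⇔ (λ h _ _ _ → h) (λ h → h refl refl ¬p)

lookup-∪ : ∀ {n} (p q : Subset n) v → lookup (p ∪ q) v ≡ lookup p v ∨ lookup q v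
lookup-∪ p q v = lookup-zipWith _∨_ v p q

lookup-∩ : ∀ {n} (p q : Subset n) v → lookup (p ∩ q) v ≡ lookup p v ∧ lookup q v
lookup-∩ p q v = lookup-zipWith _∧_ v p q

lookup-─ : ∀ {n} (p q : Subset n) v → lookup (p ─ q) v ≡ lookup p v ∧ not (lookup q v)
lookup-─ (b ∷ p) (true  ∷ q) zero    = sym (∧-zeroʳ b)
lookup-─ (b ∷ p) (false ∷ q) zero    = sym (∧-identityʳ b)
lookup-─ (_ ∷ p) (_     ∷ q) (suc v) = lookup-─ p q v

lookup-─-true : ∀ {n} (σ τ : Subset n) {x} → lookup (σ ─ τ) x ≡ true →
                lookup σ x ≡ true × lookup τ x ≡ false
lookup-─-true σ τ {x} x∈σ─τ = ∧-conicalˡ _ _ eq , not-injective (∧-conicalʳ _ _ eq)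
  where
  eq : lookup σ x ∧ not (lookup τ x) ≡ true
  eq = trans (sym (lookup-─ σ τ x)) x∈σ─τ

lookup-⁅⁆ : ∀ {n} (x : Fin n) {v} → lookup ⁅ x ⁆ v ≡ true ⇔ v ≡ x
lookup-⁅⁆ x {v} = mk⇔
  (λ eq → to x∈⁅y⁆⇔x≡y (lookup⇒[]= v ⁅ x ⁆ eq))
  (λ { refl → []=⇒lookup (x∈⁅x⁆ x) })

⊆-lookup : ∀ {n} {p q : Subset n} → p ⊆ q → ∀ {v} → lookup p v ≡ true → lookup q v ≡ true
⊆-lookup {p = p} p⊆q {v} pv = []=⇒lookup (p⊆q (lookup⇒[]= v p pv))

lookup-⊆ : ∀ {n} {p q : Subset n} → (∀ {v} → lookup p v ≡ true → lookup q v ≡ true) → p ⊆ q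
lookup-⊆ {q = q} h {v} v∈p = lookup⇒[]= v q (h ([]=⇒lookup v∈p))

lookup-[]≔false : ∀ {n} (σ : Subset n) {x w} → lookup (σ [ x ]≔ false) w ≡ true →
                  w ≢ x × lookup σ w ≡ true
lookup-[]≔false σ {x} {w} σ₀w with w ≟ x
... | yes refl = case trans (sym σ₀w) (lookup∘update x σ false) of λ ()
... | no w≢x   = w≢x , trans (sym (lookup∘update′ w≢x σ false)) σ₀w

[]≔false-⊆ : ∀ {n} {σ : Subset n} {x} → σ [ x ]≔ false ⊆ σ
[]≔false-⊆ {σ = σ} = lookup-⊆ (proj₂ ∘ lookup-[]≔false σ)

⊆-[]≔false : ∀ {n} {σ τ : Subset n} {x} → τ ⊆ σ → lookup τ x ≡ false → τ ⊆ σ [ x ]≔ false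
⊆-[]≔false {σ = σ} {x = x} τ⊆σ τx = lookup-⊆ λ {w} τw → case w ≟ x of λ where
  (yes refl) → case trans (sym τw) τx of λ ()
  (no w≢x)   → trans (lookup∘update′ w≢x σ false) (⊆-lookup τ⊆σ τw)

[]≔true-⊆ : ∀ {n} {σ τ : Subset n} {x} → τ ⊆ σ → lookup σ x ≡ true → τ [ x ]≔ true ⊆ σ
[]≔true-⊆ {τ = τ} {x} τ⊆σ σx = lookup-⊆ λ {w} τ₁w → case w ≟ x of λ where
  (yes refl) → σx
  (no w≢x)   → ⊆-lookup τ⊆σ (trans (sym (lookup∘update′ w≢x τ true)) τ₁w)

count-─-delete : ∀ {n} (σ τ : Subset n) {x} → lookup (σ ─ τ) x ≡ true →
                 count (lookup (σ ─ τ)) ≡ suc (count (lookup ((σ [ x ]≔ false) ─ τ)))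
count-─-delete σ τ {x} x∈σ─τ = count-remove-true x x∈σ─τ
  (trans (lookup-─ (σ [ x ]≔ false) τ x) (cong (_∧ not (lookup τ x)) (lookup∘update x σ false)))
  (λ v v≢x → trans (lookup-─ σ τ v)
    (trans (cong (_∧ not (lookup τ v)) (sym (lookup∘update′ v≢x σ false)))
           (sym (lookup-─ (σ [ x ]≔ false) τ v))))

count-─-insert : ∀ {n} (σ τ : Subset n) {x} → lookup (σ ─ τ) x ≡ true →
                 count (lookup (σ ─ τ)) ≡ suc (count (lookup (σ ─ (τ [ x ]≔ true))))
count-─-insert σ τ {x} x∈σ─τ = count-remove-true x x∈σ─τ
  (trans (lookup-─ σ (τ [ x ]≔ true) x)
         (trans (cong (λ b → lookup σ x ∧ not b) (lookup∘update x τ true)) (∧-zeroʳ _)))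
  (λ v v≢x → trans (lookup-─ σ τ v)
    (trans (cong (λ b → lookup σ v ∧ not b) (sym (lookup∘update′ v≢x τ true)))
           (sym (lookup-─ σ (τ [ x ]≔ true) v))))

=ˢ-true : ∀ {n} (A B : Subset n) → (A =ˢ B) ≡ true ⇔ (∀ v → lookup A v ≡ lookup B v)
=ˢ-true {n} A B = mk⇔ sound complete
  where
  sound : (A =ˢ B) ≡ true → ∀ v → lookup A v ≡ lookup B v
  sound h v with lookup A v | lookup B v | to all-allFin h v
  ... | true  | true  | _ = refl
  ... | false | false | _ = refl

  -- The pointwise test inside _=ˢ_ is local to Defs and cannot be named, so instead of
  -- proving it true at every v we refute a failing v obtained by decidability.
  complete : (∀ v → lookup A v ≡ lookup B v) → (A =ˢ B) ≡ true
  complete h with A =ˢ B in eq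
  ... | true  = refl
  ... | false with Fin.¬∀⟶∃¬ n _ (λ v → _ Bool.≟ true)
                     (λ holds → case trans (sym eq) (from all-allFin holds) of λ ())
  ...   | v , fails with lookup A v | lookup B v | h v | fails
  ...     | true  | .true  | refl | f = ⊥-elim (f refl)
  ...     | false | .false | refl | f = ⊥-elim (f refl)

=ˢ-false : ∀ {n} (A B : Subset n) x → lookup A x ≢ lookup B x → (A =ˢ B) ≡ false
=ˢ-false A B x Ax≢Bx = ¬-not λ eq → Ax≢Bx (to (=ˢ-true A B) eq x)

=ˢ-cong : ∀ {n} (A B A′ B′ : Subset n) →
          (∀ v → lookup A v ≡ lookup B v ⇔ lookup A′ v ≡ lookup B′ v) → (A =ˢ B) ≡ (A′ =ˢ B′)
=ˢ-cong A B A′ B′ pointwise = ⇔→≡ (mk⇔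
  (λ eq → from (=ˢ-true A′ B′) λ v → to   (pointwise v) (to (=ˢ-true A B) eq v))
  (λ eq → from (=ˢ-true A B)   λ v → from (pointwise v) (to (=ˢ-true A′ B′) eq v)))

=ˢ-split : ∀ {n} (A A′ B : Subset n) x → lookup A′ x ≡ false → lookup B x ≡ false →
           (∀ w → w ≢ x → lookup A′ w ≡ lookup A w) →
           (A′ =ˢ B) ≡ (A =ˢ B) ∨ (A =ˢ (B [ x ]≔ true))
=ˢ-split A A′ B x A′x Bx agree with lookup A x in Ax
... | false = begin
  (A′ =ˢ B)                          ≡⟨ =ˢ-cong A′ B A B (λ w → ≡-⇔ (A′≗A w) refl) ⟩
  (A =ˢ B)                           ≡˘⟨ ∨-identityʳ _ ⟩
  (A =ˢ B) ∨ false                   ≡˘⟨ cong ((A =ˢ B) ∨_) (=ˢ-false A (B [ x ]≔ true) x Ax≢B₁x) ⟩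
  (A =ˢ B) ∨ (A =ˢ (B [ x ]≔ true))  ∎
  where
  open ≡-Reasoning
  A′≗A : ∀ w → lookup A′ w ≡ lookup A w
  A′≗A w with w ≟ x
  ... | yes refl = trans A′x (sym Ax)
  ... | no w≢x   = agree w w≢x

  Ax≢B₁x : lookup A x ≢ lookup (B [ x ]≔ true) x
  Ax≢B₁x eq = case trans (sym Ax) (trans eq (lookup∘update x B true)) of λ ()
... | true = begin
  (A′ =ˢ B)                          ≡⟨ =ˢ-cong A′ B A (B [ x ]≔ true) shifted ⟩
  false ∨ (A =ˢ (B [ x ]≔ true))     ≡˘⟨ cong (_∨ (A =ˢ (B [ x ]≔ true))) (=ˢ-false A B x Ax≢Bx) ⟩
  (A =ˢ B) ∨ (A =ˢ (B [ x ]≔ true))  ∎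
  where
  open ≡-Reasoning
  shifted : ∀ w → lookup A′ w ≡ lookup B w ⇔ lookup A w ≡ lookup (B [ x ]≔ true) w
  shifted w with w ≟ x
  ... | yes refl = mk⇔ (λ _ → trans Ax (sym (lookup∘update x B true))) (λ _ → trans A′x (sym Bx))
  ... | no w≢x   = ≡-⇔ (agree w w≢x) (sym (lookup∘update′ w≢x B true))

  Ax≢Bx : lookup A x ≢ lookup B x
  Ax≢Bx eq = case trans (sym Ax) (trans eq Bx) of λ ()

=ˢ⇔─-empty : ∀ {n} {σ τ : Subset n} → τ ⊆ σ → (σ =ˢ τ) ≡ true ⇔ (∀ v → lookup (σ ─ τ) v ≡ false)
=ˢ⇔─-empty {σ = σ} {τ} τ⊆σ = mk⇔
  (λ eq v → to (pointwise v) (to (=ˢ-true σ τ) eq v))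
  (λ none → from (=ˢ-true σ τ) λ v → from (pointwise v) (none v))
  where
  pointwise : ∀ v → lookup σ v ≡ lookup τ v ⇔ lookup (σ ─ τ) v ≡ false
  pointwise v rewrite lookup-─ σ τ v with lookup τ v in τv | lookup σ v in σv
  ... | true  | true  = mk⇔ (λ _ → refl) (λ _ → refl)
  ... | true  | false = case trans (sym (⊆-lookup τ⊆σ τv)) σv of λ ()
  ... | false | true  = mk⇔ (λ ()) (λ ())
  ... | false | false = mk⇔ (λ _ → refl) (λ _ → refl)

─-empty⇒≗ : ∀ {n} {σ τ : Subset n} → τ ⊆ σ → (∀ v → lookup (σ ─ τ) v ≡ false) →
            ∀ v → lookup τ v ≡ lookup σ v
─-empty⇒≗ {σ = σ} {τ} τ⊆σ none v = sym (to (=ˢ-true σ τ) (from (=ˢ⇔─-empty τ⊆σ) none) v)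

-- Cliques and links

module _ (G : NumberedGraph) where

  isClique⇔ : ∀ σ → IsClique G σ ⇔
              (∀ {u w} → lookup σ u ≡ true → lookup σ w ≡ true → u ≢ w → adj G u w ≡ true)
  isClique⇔ σ = mk⇔
    (λ c {u} {w} → to (clause⇔ _ _ (u ≟ w) _) (to all-allFin (to all-allFin c u) w))
    (λ h → from all-allFin λ u → from all-allFin λ w → from (clause⇔ _ _ (u ≟ w) _) h)

  clique-⊆ : ∀ ρ σ → ρ ⊆ σ → IsClique G σ → IsClique G ρ
  clique-⊆ ρ σ ρ⊆σ c = from (isClique⇔ ρ) λ ρu ρw →
    to (isClique⇔ σ) c (⊆-lookup ρ⊆σ ρu) (⊆-lookup ρ⊆σ ρw)

  ⁅⁆-clique : ∀ v → IsClique G ⁅ v ⁆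
  ⁅⁆-clique v = from (isClique⇔ ⁅ v ⁆) λ u∈ w∈ u≢w →
    ⊥-elim (u≢w (trans (to (lookup-⁅⁆ v) u∈) (sym (to (lookup-⁅⁆ v) w∈))))

  clique-∪⁅⁆ : ∀ σ {v} → IsClique G σ → lookup σ v ≡ false →
               IsClique G (σ ∪ ⁅ v ⁆) ⇔ (∀ w → lookup σ w ≡ true → adj G v w ≡ true)
  clique-∪⁅⁆ σ {v} c σv = mk⇔
    (λ c′ w σw → to (isClique⇔ (σ ∪ ⁅ v ⁆)) c′ (∈σ∪v (inj₂ refl)) (∈σ∪v (inj₁ σw))
                   λ { refl → case trans (sym σv) σw of λ () })
    (λ v~σ → from (isClique⇔ (σ ∪ ⁅ v ⁆)) λ u∈ w∈ → extended v~σ (σ∪v∈ u∈) (σ∪v∈ w∈))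
    where
    σ∪v∈ : ∀ {u} → lookup (σ ∪ ⁅ v ⁆) u ≡ true → lookup σ u ≡ true ⊎ u ≡ v
    σ∪v∈ {u} u∈ with lookup σ u | lookup-∪ σ ⁅ v ⁆ u
    ... | true  | _  = inj₁ refl
    ... | false | eq = inj₂ (to (lookup-⁅⁆ v) (trans (sym eq) u∈))

    ∈σ∪v : ∀ {u} → lookup σ u ≡ true ⊎ u ≡ v → lookup (σ ∪ ⁅ v ⁆) u ≡ true
    ∈σ∪v {u} (inj₁ σu)   = trans (lookup-∪ σ ⁅ v ⁆ u) (cong (_∨ lookup ⁅ v ⁆ u) σu)
    ∈σ∪v {u} (inj₂ refl) = trans (lookup-∪ σ ⁅ v ⁆ u)
      (trans (cong (lookup σ u ∨_) (from (lookup-⁅⁆ v) refl)) (∨-zeroʳ _))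

    extended : (∀ w → lookup σ w ≡ true → adj G v w ≡ true) → ∀ {u w} →
               lookup σ u ≡ true ⊎ u ≡ v → lookup σ w ≡ true ⊎ w ≡ v → u ≢ w → adj G u w ≡ true
    extended v~σ         (inj₁ σu)   (inj₁ σw)   u≢w = to (isClique⇔ σ) c σu σw u≢w
    extended v~σ {u}     (inj₁ σu)   (inj₂ refl) _   = trans (adj-sym G u v) (v~σ u σu)
    extended v~σ {w = w} (inj₂ refl) (inj₁ σw)   _   = v~σ w σw
    extended v~σ         (inj₂ refl) (inj₂ refl) u≢w = ⊥-elim (u≢w refl)

  lookup-Lk : ∀ σ v → lookup (Lk G σ) v ≡ not (lookup σ v) ∧ isCliqueᵇ G (σ ∪ ⁅ v ⁆)
  lookup-Lk σ v = lookup∘tabulate _ v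

  lookup-Lk⁅⁆ : ∀ v w → lookup (Lk G ⁅ v ⁆) w ≡ adj G v w
  lookup-Lk⁅⁆ v w rewrite lookup-Lk ⁅ v ⁆ w with w ≟ v
  ... | yes refl rewrite from (lookup-⁅⁆ v) refl = sym (adj-irref G v)
  ... | no w≢v rewrite ¬-not (w≢v ∘ to (lookup-⁅⁆ v {w})) = ⇔→≡ (mk⇔
    (λ c → trans (adj-sym G v w) (to w~v⇔ c v (from (lookup-⁅⁆ v) refl)))
    (λ v~w → from w~v⇔ λ u u∈ →
       subst (λ u → adj G w u ≡ true) (sym (to (lookup-⁅⁆ v) u∈)) (trans (adj-sym G w v) v~w)))
    where
    w~v⇔ : IsClique G (⁅ v ⁆ ∪ ⁅ w ⁆) ⇔ (∀ u → lookup ⁅ v ⁆ u ≡ true → adj G w u ≡ true)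
    w~v⇔ = clique-∪⁅⁆ ⁅ v ⁆ (⁅⁆-clique v) (¬-not (w≢v ∘ to (lookup-⁅⁆ v)))

  lookup-Lk⁅⁆∩ : ∀ v σ w → lookup (Lk G ⁅ v ⁆ ∩ σ) w ≡ adj G v w ∧ lookup σ w
  lookup-Lk⁅⁆∩ v σ w = trans (lookup-∩ (Lk G ⁅ v ⁆) σ w) (cong (_∧ lookup σ w) (lookup-Lk⁅⁆ v w))

  lookup-LkRel : ∀ σ τ v → lookup (LkRel G σ τ) v ≡ not (lookup σ v) ∧ ((Lk G ⁅ v ⁆ ∩ σ) =ˢ τ)
  lookup-LkRel σ τ v = lookup∘tabulate _ v

  LkRel-∉ : ∀ σ τ {v} → lookup σ v ≡ true → lookup (LkRel G σ τ) v ≡ false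
  LkRel-∉ σ τ {v} σv = trans (lookup-LkRel σ τ v) (cong (λ b → not b ∧ ((Lk G ⁅ v ⁆ ∩ σ) =ˢ τ)) σv)

  LkRel-self : ∀ σ τ → IsClique G σ → (∀ w → lookup τ w ≡ lookup σ w) →
               ∀ v → lookup (LkRel G σ τ) v ≡ lookup (Lk G σ) v
  LkRel-self σ τ c τ≗σ v rewrite lookup-LkRel σ τ v | lookup-Lk σ v with lookup σ v in σv
  ... | true  = refl
  ... | false = ⇔→≡ (mk⇔
    (λ eq → from v~σ⇔ λ w σw →
       ∧-conicalˡ _ _ (trans (sym (lookup-Lk⁅⁆∩ v σ w))
                             (trans (to (=ˢ-true (Lk G ⁅ v ⁆ ∩ σ) τ) eq w) (trans (τ≗σ w) σw))))
    (λ c′ → from (=ˢ-true (Lk G ⁅ v ⁆ ∩ σ) τ) λ w →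
       trans (lookup-Lk⁅⁆∩ v σ w) (trans (∧-≡ʳ (to v~σ⇔ c′ w)) (sym (τ≗σ w)))))
    where
    v~σ⇔ : IsClique G (σ ∪ ⁅ v ⁆) ⇔ (∀ w → lookup σ w ≡ true → adj G v w ≡ true)
    v~σ⇔ = clique-∪⁅⁆ σ c σv

  LkRel-disjoint : ∀ σ τ τ′ x → lookup τ x ≢ lookup τ′ x →
                   ∀ v → lookup (LkRel G σ τ) v ∧ lookup (LkRel G σ τ′) v ≡ false
  LkRel-disjoint σ τ τ′ x τx≢τ′x v = ¬-not λ both →
    τx≢τ′x (trans (sym (trace τ (∧-conicalˡ _ _ both))) (trace τ′ (∧-conicalʳ _ _ both)))
    where
    trace : ∀ ρ → lookup (LkRel G σ ρ) v ≡ true → lookup (Lk G ⁅ v ⁆ ∩ σ) x ≡ lookup ρ x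
    trace ρ eq = to (=ˢ-true (Lk G ⁅ v ⁆ ∩ σ) ρ)
                   (∧-conicalʳ _ _ (trans (sym (lookup-LkRel σ ρ v)) eq)) x

  -- A vertex outside σ sees τ in σ ∖ x exactly when it sees τ in σ (not adjacent to x)
  -- or τ ∪ x in σ (adjacent to x).
  lookup-LkRel-delete : ∀ σ τ {x} → lookup τ x ≡ false → ∀ {v} → v ≢ x →
                        lookup (LkRel G (σ [ x ]≔ false) τ) v ≡
                        lookup (LkRel G σ τ ∪ LkRel G σ (τ [ x ]≔ true)) v
  lookup-LkRel-delete σ τ {x} τx {v} v≢x
    rewrite lookup-∪ (LkRel G σ τ) (LkRel G σ (τ [ x ]≔ true)) v
          | lookup-LkRel (σ [ x ]≔ false) τ v | lookup-LkRel σ τ v | lookup-LkRel σ (τ [ x ]≔ true) v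
          | lookup∘update′ v≢x σ false
    with lookup σ v
  ... | true  = refl
  ... | false = =ˢ-split (Lk G ⁅ v ⁆ ∩ σ) (Lk G ⁅ v ⁆ ∩ (σ [ x ]≔ false)) τ x
    (trans (lookup-Lk⁅⁆∩ v _ x) (trans (cong (adj G v x ∧_) (lookup∘update x σ false)) (∧-zeroʳ _)))
    τx
    (λ w w≢x → trans (lookup-Lk⁅⁆∩ v _ w)
                 (trans (cong (adj G v w ∧_) (lookup∘update′ w≢x σ false)) (sym (lookup-Lk⁅⁆∩ v σ w))))

  lookup-LkRel-delete-at : ∀ σ τ {x} → IsClique G σ → lookup σ x ≡ true →
                           lookup (LkRel G (σ [ x ]≔ false) τ) x ≡ ((σ [ x ]≔ false) =ˢ τ)
  lookup-LkRel-delete-at σ τ {x} c σx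
    rewrite lookup-LkRel (σ [ x ]≔ false) τ x | lookup∘update x σ false =
    =ˢ-cong (Lk G ⁅ x ⁆ ∩ (σ [ x ]≔ false)) τ (σ [ x ]≔ false) τ λ w →
      ≡-⇔ (trans (lookup-Lk⁅⁆∩ x _ w) (∧-≡ʳ (x~σ₀ w))) refl
    where
    x~σ₀ : ∀ w → lookup (σ [ x ]≔ false) w ≡ true → adj G x w ≡ true
    x~σ₀ w σ₀w = let w≢x , σw = lookup-[]≔false σ σ₀w in
      to (isClique⇔ σ) c σx σw (w≢x ∘ sym)

  -- Multiplicities

  mult-count : ∀ U k → mult G U k ≡ count (λ v → lookup U v ∧ (N G v ≡ᵇ k))
  mult-count U k = length-filterᵇ-tabulate (λ v → lookup U v ∧ (N G v ≡ᵇ k)) id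

  mult-cong : ∀ U W → (∀ v → lookup U v ≡ lookup W v) → ∀ k → mult G U k ≡ mult G W k
  mult-cong U W U≗W k = begin
    mult G U k                               ≡⟨ mult-count U k ⟩
    count (λ v → lookup U v ∧ (N G v ≡ᵇ k))  ≡⟨ count-cong (λ v → cong (_∧ (N G v ≡ᵇ k)) (U≗W v)) ⟩
    count (λ v → lookup W v ∧ (N G v ≡ᵇ k))  ≡˘⟨ mult-count W k ⟩
    mult G W k                               ∎
    where open ≡-Reasoning

  mult-+ : ∀ U V W → (∀ v → χ (lookup U v) ≡ χ (lookup V v) + χ (lookup W v)) →
           ∀ k → mult G U k ≡ mult G V k + mult G W k
  mult-+ U V W split k = begin
    mult G U k
      ≡⟨ mult-count U k ⟩
    count (λ v → lookup U v ∧ (N G v ≡ᵇ k))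
      ≡⟨ count-+ (λ v → χ-∧ʳ (lookup U v) (lookup V v) (lookup W v) (N G v ≡ᵇ k) (split v)) ⟩
    count (λ v → lookup V v ∧ (N G v ≡ᵇ k)) + count (λ v → lookup W v ∧ (N G v ≡ᵇ k))
      ≡˘⟨ cong₂ _+_ (mult-count V k) (mult-count W k) ⟩
    mult G V k + mult G W k
      ∎
    where open ≡-Reasoning

  mult-∪ : ∀ U W → (∀ v → lookup U v ∧ lookup W v ≡ false) →
           ∀ k → mult G (U ∪ W) k ≡ mult G U k + mult G W k
  mult-∪ U W disjoint = mult-+ (U ∪ W) U W split
    where
    split : ∀ v → χ (lookup (U ∪ W) v) ≡ χ (lookup U v) + χ (lookup W v)
    split v rewrite lookup-∪ U W v with lookup U v | lookup W v | disjoint v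
    ... | false | _     | _  = refl
    ... | true  | false | _  = refl
    ... | true  | true  | ()

  mult-─ : ∀ σ τ → τ ⊆ σ → ∀ k → mult G σ k ≡ mult G τ k + mult G (σ ─ τ) k
  mult-─ σ τ τ⊆σ = mult-+ σ τ (σ ─ τ) split
    where
    split : ∀ v → χ (lookup σ v) ≡ χ (lookup τ v) + χ (lookup (σ ─ τ) v)
    split v rewrite lookup-─ σ τ v with lookup τ v in τv | lookup σ v in σv
    ... | true  | true  = refl
    ... | true  | false = case trans (sym (⊆-lookup τ⊆σ τv)) σv of λ ()
    ... | false | true  = refl
    ... | false | false = refl

  mult-remove : ∀ U W x → lookup W x ≡ false → (∀ v → v ≢ x → lookup U v ≡ lookup W v) →
                ∀ k → mult G U k ≡ χ (lookup U x ∧ (N G x ≡ᵇ k)) + mult G W k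
  mult-remove U W x Wx agree k = begin
    mult G U k
      ≡⟨ mult-count U k ⟩
    count (λ v → lookup U v ∧ (N G v ≡ᵇ k))
      ≡⟨ count-remove x (cong (_∧ (N G x ≡ᵇ k)) Wx) (λ v v≢x → cong (_∧ (N G v ≡ᵇ k)) (agree v v≢x)) ⟩
    χ (lookup U x ∧ (N G x ≡ᵇ k)) + count (λ v → lookup W v ∧ (N G v ≡ᵇ k))
      ≡˘⟨ cong (χ (lookup U x ∧ (N G x ≡ᵇ k)) +_) (mult-count W k) ⟩
    χ (lookup U x ∧ (N G x ≡ᵇ k)) + mult G W k
      ∎
    where open ≡-Reasoning

  mult-delete : ∀ U {x} → lookup U x ≡ true →
                ∀ k → mult G U k ≡ χ (N G x ≡ᵇ k) + mult G (U [ x ]≔ false) k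
  mult-delete U {x} Ux k = trans
    (mult-remove U (U [ x ]≔ false) x (lookup∘update x U false)
                 (λ v v≢x → sym (lookup∘update′ v≢x U false)) k)
    (cong (λ b → χ (b ∧ (N G x ≡ᵇ k)) + mult G (U [ x ]≔ false) k) Ux)

  mult-insert : ∀ U {x} → lookup U x ≡ false →
                ∀ k → mult G (U [ x ]≔ true) k ≡ χ (N G x ≡ᵇ k) + mult G U k
  mult-insert U {x} Ux k = trans
    (mult-remove (U [ x ]≔ true) U x Ux (λ v v≢x → lookup∘update′ v≢x U true) k)
    (cong (λ b → χ (b ∧ (N G x ≡ᵇ k)) + mult G U k) (lookup∘update x U true))

  mult-≢0 : ∀ U {v} → lookup U v ≡ true → mult G U (N G v) ≢ 0
  mult-≢0 U {v} Uv mult≡0 =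
    count-≢0 v (cong₂ _∧_ Uv (to T-≡ (≡⇒≡ᵇ (N G v) (N G v) refl)))
               (trans (sym (mult-count U (N G v))) mult≡0)

  mult-≢0⇒∃ : ∀ U {k} → mult G U k ≢ 0 → ∃ λ v → lookup U v ≡ true × N G v ≡ k
  mult-≢0⇒∃ U {k} mult≢0 with count-≢0⇒∃ (mult≢0 ∘ trans (mult-count U k))
  ... | v , eq = v , ∧-conicalˡ _ _ eq , ≡ᵇ⇒≡ (N G v) k (from T-≡ (∧-conicalʳ _ _ eq))

  mult-empty : ∀ U → (∀ v → lookup U v ≡ false) → ∀ k → mult G U k ≡ 0
  mult-empty U none k =
    trans (mult-count U k) (count-all-false λ v → cong (_∧ (N G v ≡ᵇ k)) (none v))

  mult-LkRel-delete : ∀ σ τ {x} → IsClique G σ → lookup (σ ─ τ) x ≡ true → ∀ k →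
    mult G (LkRel G (σ [ x ]≔ false) τ) k ≡
    χ (((σ [ x ]≔ false) =ˢ τ) ∧ (N G x ≡ᵇ k)) +
      (mult G (LkRel G σ τ) k + mult G (LkRel G σ (τ [ x ]≔ true)) k)
  mult-LkRel-delete σ τ {x} c x∈σ─τ k = begin
    mult G (LkRel G σ₀ τ) k
      ≡⟨ mult-remove (LkRel G σ₀ τ) (R ∪ R₁) x R∪R₁x (λ v → lookup-LkRel-delete σ τ τx) k ⟩
    χ (lookup (LkRel G σ₀ τ) x ∧ (N G x ≡ᵇ k)) + mult G (R ∪ R₁) k
      ≡⟨ cong₂ (λ b m → χ (b ∧ (N G x ≡ᵇ k)) + m)
               (lookup-LkRel-delete-at σ τ c σx)
               (mult-∪ R R₁ (LkRel-disjoint σ τ (τ [ x ]≔ true) x τx≢τ₁x) k) ⟩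
    χ ((σ₀ =ˢ τ) ∧ (N G x ≡ᵇ k)) + (mult G R k + mult G R₁ k)
      ∎
    where
    open ≡-Reasoning
    σx : lookup σ x ≡ true
    σx = proj₁ (lookup-─-true σ τ x∈σ─τ)
    τx : lookup τ x ≡ false
    τx = proj₂ (lookup-─-true σ τ x∈σ─τ)

    σ₀ R R₁ : Vset G
    σ₀ = σ [ x ]≔ false
    R  = LkRel G σ τ
    R₁ = LkRel G σ (τ [ x ]≔ true)

    R∪R₁x : lookup (R ∪ R₁) x ≡ false
    R∪R₁x = trans (lookup-∪ R R₁ x) (cong₂ _∨_ (LkRel-∉ σ τ σx) (LkRel-∉ σ (τ [ x ]≔ true) σx))

    τx≢τ₁x : lookup τ x ≢ lookup (τ [ x ]≔ true) x
    τx≢τ₁x eq = case trans (sym τx) (trans eq (lookup∘update x τ true)) of λ ()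

module _ (G G′ : NumberedGraph) where

  SameN-─ : ∀ {σ τ σ′ τ′} → τ ⊆ σ → τ′ ⊆ σ′ → SameN G G′ σ σ′ → SameN G G′ τ τ′ →
            SameN G G′ (σ ─ τ) (σ′ ─ τ′)
  SameN-─ {σ} {τ} {σ′} {τ′} τ⊆σ τ′⊆σ′ sameσ sameτ k = +-cancelˡ-≡ (mult G τ k) _ _ (begin
    mult G τ k + mult G (σ ─ τ) k       ≡˘⟨ mult-─ G σ τ τ⊆σ k ⟩
    mult G σ k                          ≡⟨ sameσ k ⟩
    mult G′ σ′ k                        ≡⟨ mult-─ G′ σ′ τ′ τ′⊆σ′ k ⟩
    mult G′ τ′ k + mult G′ (σ′ ─ τ′) k  ≡˘⟨ cong (_+ mult G′ (σ′ ─ τ′) k) (sameτ k) ⟩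
    mult G τ k + mult G′ (σ′ ─ τ′) k    ∎)
    where open ≡-Reasoning

  SameN-delete : ∀ σ σ′ {x x′} → lookup σ x ≡ true → lookup σ′ x′ ≡ true → N G x ≡ N G′ x′ →
                 SameN G G′ σ σ′ → SameN G G′ (σ [ x ]≔ false) (σ′ [ x′ ]≔ false)
  SameN-delete σ σ′ {x} {x′} σx σ′x′ Nx≡Nx′ sameσ k = +-cancelˡ-≡ (χ (N G x ≡ᵇ k)) _ _ (begin
    χ (N G x ≡ᵇ k) + mult G (σ [ x ]≔ false) k
      ≡˘⟨ mult-delete G σ σx k ⟩
    mult G σ k
      ≡⟨ sameσ k ⟩
    mult G′ σ′ k
      ≡⟨ mult-delete G′ σ′ σ′x′ k ⟩
    χ (N G′ x′ ≡ᵇ k) + mult G′ (σ′ [ x′ ]≔ false) k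
      ≡˘⟨ cong (λ m → χ (m ≡ᵇ k) + mult G′ (σ′ [ x′ ]≔ false) k) Nx≡Nx′ ⟩
    χ (N G x ≡ᵇ k) + mult G′ (σ′ [ x′ ]≔ false) k
      ∎)
    where open ≡-Reasoning

  SameN-insert : ∀ τ τ′ {x x′} → lookup τ x ≡ false → lookup τ′ x′ ≡ false → N G x ≡ N G′ x′ →
                 SameN G G′ τ τ′ → SameN G G′ (τ [ x ]≔ true) (τ′ [ x′ ]≔ true)
  SameN-insert τ τ′ {x} {x′} τx τ′x′ Nx≡Nx′ sameτ k = begin
    mult G (τ [ x ]≔ true) k         ≡⟨ mult-insert G τ τx k ⟩
    χ (N G x ≡ᵇ k) + mult G τ k      ≡⟨ cong₂ (λ m n → χ (m ≡ᵇ k) + n) Nx≡Nx′ (sameτ k) ⟩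
    χ (N G′ x′ ≡ᵇ k) + mult G′ τ′ k  ≡˘⟨ mult-insert G′ τ′ τ′x′ k ⟩
    mult G′ (τ′ [ x′ ]≔ true) k      ∎
    where open ≡-Reasoning

  SameN-empty : ∀ U U′ → SameN G G′ U U′ → (∀ v → lookup U v ≡ false) → ∀ v → lookup U′ v ≡ false
  SameN-empty U U′ same none v = ¬-not λ U′v →
    mult-≢0 G′ U′ U′v (trans (sym (same (N G′ v))) (mult-empty G U none (N G′ v)))

  SameN-∃ : ∀ U U′ {x} → SameN G G′ U U′ → lookup U x ≡ true →
            ∃ λ x′ → lookup U′ x′ ≡ true × N G x ≡ N G′ x′
  SameN-∃ U U′ {x} same Ux =
    map id (map id sym) (mult-≢0⇒∃ G′ U′ (mult-≢0 G U Ux ∘ trans (same (N G x))))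

SameN-=ˢ : ∀ G G′ {σ τ σ′ τ′} → τ ⊆ σ → τ′ ⊆ σ′ → SameN G G′ σ σ′ → SameN G G′ τ τ′ →
           (σ =ˢ τ) ≡ (σ′ =ˢ τ′)
SameN-=ˢ G G′ {σ} {τ} {σ′} {τ′} τ⊆σ τ′⊆σ′ sameσ sameτ = ⇔→≡ (mk⇔
  (from (=ˢ⇔─-empty τ′⊆σ′) ∘ SameN-empty G G′ (σ ─ τ) (σ′ ─ τ′) same─ ∘ to (=ˢ⇔─-empty τ⊆σ))
  (from (=ˢ⇔─-empty τ⊆σ) ∘ SameN-empty G′ G (σ′ ─ τ′) (σ ─ τ) (sym ∘ same─) ∘ to (=ˢ⇔─-empty τ′⊆σ′)))
  where
  same─ : SameN G G′ (σ ─ τ) (σ′ ─ τ′)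
  same─ = SameN-─ G G′ τ⊆σ τ′⊆σ′ sameσ sameτ

module _ (G G′ : NumberedGraph) where

  SameN-LkRel-cancel : ∀ σ τ σ′ τ′ {x x′} → IsClique G σ → IsClique G′ σ′ →
    lookup (σ ─ τ) x ≡ true → lookup (σ′ ─ τ′) x′ ≡ true → N G x ≡ N G′ x′ →
    ((σ [ x ]≔ false) =ˢ τ) ≡ ((σ′ [ x′ ]≔ false) =ˢ τ′) →
    SameN G G′ (LkRel G (σ [ x ]≔ false) τ) (LkRel G′ (σ′ [ x′ ]≔ false) τ′) →
    SameN G G′ (LkRel G σ (τ [ x ]≔ true)) (LkRel G′ σ′ (τ′ [ x′ ]≔ true)) →
    SameN G G′ (LkRel G σ τ) (LkRel G′ σ′ τ′)
  SameN-LkRel-cancel σ τ σ′ τ′ {x} {x′} c c′ x∈σ─τ x′∈σ′─τ′ Nx≡Nx′ tests≡ same₀ same₁ k =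
    +-cancelʳ-≡ _ _ _ (+-cancelˡ-≡ (χ (b ∧ (N G x ≡ᵇ k))) _ _ (begin
      χ (b ∧ (N G x ≡ᵇ k)) + (mult G R k + mult G R₁ k)
        ≡˘⟨ mult-LkRel-delete G σ τ c x∈σ─τ k ⟩
      mult G (LkRel G (σ [ x ]≔ false) τ) k
        ≡⟨ same₀ k ⟩
      mult G′ (LkRel G′ (σ′ [ x′ ]≔ false) τ′) k
        ≡⟨ mult-LkRel-delete G′ σ′ τ′ c′ x′∈σ′─τ′ k ⟩
      χ (b′ ∧ (N G′ x′ ≡ᵇ k)) + (mult G′ R′ k + mult G′ R₁′ k)
        ≡˘⟨ cong₂ (λ b m → χ (b ∧ (m ≡ᵇ k)) + (mult G′ R′ k + mult G′ R₁′ k)) tests≡ Nx≡Nx′ ⟩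
      χ (b ∧ (N G x ≡ᵇ k)) + (mult G′ R′ k + mult G′ R₁′ k)
        ≡˘⟨ cong (λ m → χ (b ∧ (N G x ≡ᵇ k)) + (mult G′ R′ k + m)) (same₁ k) ⟩
      χ (b ∧ (N G x ≡ᵇ k)) + (mult G′ R′ k + mult G R₁ k)
        ∎))
    where
    open ≡-Reasoning
    b b′ : Bool
    b  = (σ [ x ]≔ false) =ˢ τ
    b′ = (σ′ [ x′ ]≔ false) =ˢ τ′
    R R₁ : Vset G
    R  = LkRel G σ τ
    R₁ = LkRel G σ (τ [ x ]≔ true)
    R′ R₁′ : Vset G′
    R′  = LkRel G′ σ′ τ′
    R₁′ = LkRel G′ σ′ (τ′ [ x′ ]≔ true)

LinkEquivalent : NumberedGraph → NumberedGraph → Set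
LinkEquivalent G G′ = ∀ σ σ′ → IsClique G σ → IsClique G′ σ′ →
  SameN G G′ σ σ′ → SameN G G′ (Lk G σ) (Lk G′ σ′)

module _ {G G′ : NumberedGraph} (links : LinkEquivalent G G′) where

  SameN-LkRel : ∀ d σ τ σ′ τ′ → count (lookup (σ ─ τ)) ≡ d →
                IsClique G σ → IsClique G′ σ′ → SameN G G′ σ σ′ →
                τ ⊆ σ → τ′ ⊆ σ′ → SameN G G′ τ τ′ →
                SameN G G′ (LkRel G σ τ) (LkRel G′ σ′ τ′)
  SameN-LkRel zero σ τ σ′ τ′ size≡0 c c′ sameσ τ⊆σ τ′⊆σ′ sameτ k = begin
    mult G (LkRel G σ τ) k
      ≡⟨ mult-cong G (LkRel G σ τ) (Lk G σ) (LkRel-self G σ τ c (─-empty⇒≗ τ⊆σ σ─τ-empty)) k ⟩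
    mult G (Lk G σ) k
      ≡⟨ links σ σ′ c c′ sameσ k ⟩
    mult G′ (Lk G′ σ′) k
      ≡˘⟨ mult-cong G′ (LkRel G′ σ′ τ′) (Lk G′ σ′)
                    (LkRel-self G′ σ′ τ′ c′ (─-empty⇒≗ τ′⊆σ′ σ′─τ′-empty)) k ⟩
    mult G′ (LkRel G′ σ′ τ′) k
      ∎
    where
    open ≡-Reasoning
    σ─τ-empty : ∀ v → lookup (σ ─ τ) v ≡ false
    σ─τ-empty = count-≡0⇒false size≡0
    σ′─τ′-empty : ∀ v → lookup (σ′ ─ τ′) v ≡ false
    σ′─τ′-empty = SameN-empty G G′ (σ ─ τ) (σ′ ─ τ′) (SameN-─ G G′ τ⊆σ τ′⊆σ′ sameσ sameτ) σ─τ-empty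
  SameN-LkRel (suc d) σ τ σ′ τ′ size c c′ sameσ τ⊆σ τ′⊆σ′ sameτ
    with count-≢0⇒∃ {P = lookup (σ ─ τ)} (λ size≡0 → 0≢1+n (trans (sym size≡0) size))
  ... | x , x∈σ─τ
    with SameN-∃ G G′ (σ ─ τ) (σ′ ─ τ′) (SameN-─ G G′ τ⊆σ τ′⊆σ′ sameσ sameτ) x∈σ─τ
  ... | x′ , x′∈σ′─τ′ , Nx≡Nx′ =
    SameN-LkRel-cancel G G′ σ τ σ′ τ′ c c′ x∈σ─τ x′∈σ′─τ′ Nx≡Nx′
      (SameN-=ˢ G G′ τ⊆σ₀ τ′⊆σ₀′ sameσ₀ sameτ)
      (SameN-LkRel d σ₀ τ σ₀′ τ′ (suc-injective (trans (sym (count-─-delete σ τ x∈σ─τ)) size))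
         (clique-⊆ G σ₀ σ []≔false-⊆ c) (clique-⊆ G′ σ₀′ σ′ []≔false-⊆ c′) sameσ₀ τ⊆σ₀ τ′⊆σ₀′ sameτ)
      (SameN-LkRel d σ (τ [ x ]≔ true) σ′ (τ′ [ x′ ]≔ true)
         (suc-injective (trans (sym (count-─-insert σ τ x∈σ─τ)) size)) c c′ sameσ
         ([]≔true-⊆ τ⊆σ σx) ([]≔true-⊆ τ′⊆σ′ σ′x′) (SameN-insert G G′ τ τ′ τx τ′x′ Nx≡Nx′ sameτ))
    where
    σx : lookup σ x ≡ true
    σx = proj₁ (lookup-─-true σ τ x∈σ─τ)
    τx : lookup τ x ≡ false
    τx = proj₂ (lookup-─-true σ τ x∈σ─τ)
    σ′x′ : lookup σ′ x′ ≡ true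
    σ′x′ = proj₁ (lookup-─-true σ′ τ′ x′∈σ′─τ′)
    τ′x′ : lookup τ′ x′ ≡ false
    τ′x′ = proj₂ (lookup-─-true σ′ τ′ x′∈σ′─τ′)

    σ₀ : Vset G
    σ₀ = σ [ x ]≔ false
    σ₀′ : Vset G′
    σ₀′ = σ′ [ x′ ]≔ false

    sameσ₀ : SameN G G′ σ₀ σ₀′
    sameσ₀ = SameN-delete G G′ σ σ′ σx σ′x′ Nx≡Nx′ sameσ
    τ⊆σ₀ : τ ⊆ σ₀
    τ⊆σ₀ = ⊆-[]≔false τ⊆σ τx
    τ′⊆σ₀′ : τ′ ⊆ σ₀′
    τ′⊆σ₀′ = ⊆-[]≔false τ′⊆σ′ τ′x′

corollary5p9 : (G G' : NumberedGraph) →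
    LinkRegular G → LinkRegular G' → Equivalent G G' →
    (σ : Vset G) (σ' : Vset G') → IsClique G σ → IsClique G' σ' →
    SameN G G' σ σ' →
    (τ : Vset G) (τ' : Vset G') → τ ⊆ σ → τ' ⊆ σ' →
    SameN G G' τ τ' →
    SameN G G' (LkRel G σ τ) (LkRel G' σ' τ')
corollary5p9 G G′ _ _ (_ , links) σ σ′ c c′ sameσ τ τ′ τ⊆σ τ′⊆σ′ sameτ =
  SameN-LkRel {G} {G′} links _ σ τ σ′ τ′ refl c c′ sameσ τ⊆σ τ′⊆σ′ sameτ
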